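{- Let $\mathcal F \subset \binom{[n]}{k}$ be initial and let $q$ be a positive integer with $q < n$. Let $P \subset R \subset [q]$ with $|R| \leq k$. Then $$\frac{\left|\mathcal F\left(P, \overline{[q]\setminus P}\right)\right|}{\binom{n-q}{k-|P|}} \leq \frac{\left|\mathcal F\left(R, \overline{[q]\setminus R}\right)\right|}{\binom{n-q}{k-|R|}}.$$
   Context: $[n] = \{1,\dots,n\}$, $\binom{[n]}{k}$ is the collection of $k$-element subsets of $[n]$. For disjoint sets $A, B$, $\mathcal F(A, \overline B) = \{F \setminus A : A \subset F \in \mathcal F,\ F \cap B = \emptyset\}$; thus $\mathcal F(P, \overline{[q]\setminus P}) = \{F \setminus P : F \in \mathcal F, F \cap [q] = P\}$. For $k$-sets $A = \{x_1<\dots<x_k\}$, $B = \{y_1<\dots<y_k\}$ write $A \prec B$ if $x_i \leq y_i$ for all $i$; $\mathcal F$ is initial if $A \prec B$ and $B \in \mathcal F$ imply $A \in \mathcal F$. -}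

module Defs where

open import Data.Nat using (ℕ; zero; suc; _<ᵇ_)
open import Data.Bool using (Bool; true; false; _∧_)
open import Data.Fin using (Fin; toℕ) renaming (zero to fzero; suc to fsuc)
import Data.Fin as Fin
open import Data.Fin.Subset using (Subset; _∩_)
open import Data.Vec using (Vec; []; _∷_; tabulate)
open import Data.Vec.Properties using (≡-dec)
open import Data.List using (List; []; _∷_; map; _++_; filterᵇ; length)
open import Data.List.Relation.Binary.Pointwise using (Pointwise)
open import Relation.Nullary.Decidable using (⌊_⌋)
open import Relation.Binary.PropositionalEquality using (_≡_)
import Data.Bool.Properties as BoolP

elems : ∀ {n} → Subset n → List (Fin n)
elems [] = []
elems (true ∷ p) = fzero ∷ map fsuc (elems p)
elems (false ∷ p) = map fsuc (elems p)

-- A ≺ B : A = {x₁<…<x_k}, B = {y₁<…<y_k} (same size) and x_i ≤ y_i for all i.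
_≺_ : ∀ {n} → Subset n → Subset n → Set
A ≺ B = Pointwise Fin._≤_ (elems A) (elems B)

Family : ℕ → Set
Family n = Subset n → Bool

IsKUniform : ∀ {n} → ℕ → Family n → Set
IsKUniform {n} k 𝓕 = ∀ (A : Subset n) → 𝓕 A ≡ true → Data.Fin.Subset.∣ A ∣ ≡ k

Initial : ∀ {n} → Family n → Set
Initial {n} 𝓕 = ∀ (A B : Subset n) → A ≺ B → 𝓕 B ≡ true → 𝓕 A ≡ true

allSubsets : ∀ n → List (Subset n)
allSubsets zero = [] ∷ []
allSubsets (suc n) = map (false ∷_) (allSubsets n) ++ map (true ∷_) (allSubsets n)

-- [q] = {1,…,q} as a subset of [n] (elements are Fin n = {0,…,n-1}, i ↦ i+1).
initSeg : ∀ n → ℕ → Subset n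
initSeg n q = tabulate (λ i → toℕ i <ᵇ q)

_==ˢ_ : ∀ {n} → Subset n → Subset n → Bool
A ==ˢ B = ⌊ ≡-dec BoolP._≟_ A B ⌋

-- |𝓕(P, \overline{[q] ∖ P})| = #{F ∈ 𝓕 : F ∩ [q] = P}
-- (F ↦ F ∖ P is injective on these F, so this is the cardinality of the restricted family)
restrictCard : ∀ {n} → Family n → ℕ → Subset n → ℕ
restrictCard {n} 𝓕 q P =
  length (filterᵇ (λ F → 𝓕 F ∧ ((F ∩ initSeg n q) ==ˢ P)) (allSubsets n))

-- Split [n] = [q] ⊔ [m] with m = n − q and write a subset of [n] as a ++ g with a ⊆ [q]
-- and g ⊆ [m]. For a ⊆ [q], trace a counts the g with a ++ g ∈ 𝓕; this is the numerator
-- |𝓕(a, [q] ∖ a)|. Along the chain P = u₀ ⋖ u₁ ⋖ ⋯ ⋖ R (each step adds one point of [q]) it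
-- suffices to compare neighbours u ⋖ w. The g counted by u have size s + 1 and those counted
-- by w have size s = k − |w|. Removing a point y from such a g gives w ++ (g − y) ≺ u ++ g,
-- since the point added in [q] precedes y. So by initiality the family counted by w contains
-- the shadow of the family counted by u, and the local LYM inequality
-- |A| C(m, s) ≤ |∂A| C(m, s + 1) gives the step.

module Submission where

open import Defs
open import Data.Nat using (ℕ; zero; suc; _+_; _*_; _∸_; _≤_; _<_; z≤n; s≤s; _≤?_)
open import Data.Nat.Properties
open import Data.Nat.Combinatorics using (_C_; nC1≡n; nCk+nC[k+1]≡[n+1]C[k+1]; k>n⇒nCk≡0)
open import Algebra.Properties.CommutativeSemigroup +-commutativeSemigroup using (interchange)
open import Algebra.Properties.CommutativeSemigroup *-commutativeSemigroup using (xy∙z≈xz∙y)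
open import Function using (_∘_)
open import Data.Bool using (Bool; true; false; _∧_)
open import Data.Bool.Properties as BoolP using (∧-zeroʳ; ∧-identityʳ)
open import Data.Fin using (Fin) renaming (zero to fzero; suc to fsuc)
import Data.Fin as Fin
import Data.Fin.Properties as Finₚ
open import Data.Fin.Subset using (Subset; _⊆_; ∣_∣; _∩_; ⊤; ⊥; inside; outside)
open import Data.Fin.Subset.Properties
  using (∣p∣≤n; ∣⊥∣≡0; drop-∷-⊆; out⊆; s⊆s; ⊆-refl; ⊆-trans; ⊆-antisym; ⊥⊆; ∩-identityʳ; ∩-zeroʳ)
open import Data.Vec using ([]; _∷_; _++_; tail; here)
open import Data.Vec.Properties using (≡-dec; ++-injectiveˡ; zipWith-++)
open import Data.List as List using (List; filterᵇ; length; map)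
open import Data.Nat.ListAction using (sum)
open import Data.Nat.ListAction.Properties using (sum-++)
import Data.List.Properties as Listₚ
open import Data.List.Relation.Binary.Pointwise using (Pointwise; _∷_; map⁺)
import Data.List.Relation.Binary.Pointwise as Pointwise
open import Data.Product using (∃-syntax; _,_)
open import Relation.Binary.Construct.Closure.ReflexiveTransitive using (Star; ε; _◅_; _◅◅_; gmap)
open import Relation.Binary.PropositionalEquality
open import Relation.Nullary using (Dec; yes; no; contradiction)
open import Relation.Nullary.Decidable using (isYes≗does; dec-true; dec-false)

𝟙 : Bool → ℕ
𝟙 true = 1
𝟙 false = 0

𝟙-mono-≤ : ∀ {a b} → (a ≡ true → b ≡ true) → 𝟙 a ≤ 𝟙 b
𝟙-mono-≤ {false} _ = z≤n
𝟙-mono-≤ {true} a⇒b rewrite a⇒b refl = ≤-refl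

∑ : ∀ m → (Subset m → ℕ) → ℕ
∑ zero f = f []
∑ (suc m) f = ∑ m (λ g → f (outside ∷ g)) + ∑ m (λ g → f (inside ∷ g))

count : ∀ {m} → Family m → ℕ
count {m} A = ∑ m (λ g → 𝟙 (A g))

weight : ∀ {m} → Family m → (Subset m → ℕ) → ℕ
weight {m} A w = ∑ m (λ g → 𝟙 (A g) * w g)

∑-cong : ∀ m {f g : Subset m → ℕ} → (∀ x → f x ≡ g x) → ∑ m f ≡ ∑ m g
∑-cong zero f≗g = f≗g []
∑-cong (suc m) f≗g =
  cong₂ _+_ (∑-cong m (λ x → f≗g (outside ∷ x))) (∑-cong m (λ x → f≗g (inside ∷ x)))

∑-mono-≤ : ∀ m {f g : Subset m → ℕ} → (∀ x → f x ≤ g x) → ∑ m f ≤ ∑ m g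
∑-mono-≤ zero f≤g = f≤g []
∑-mono-≤ (suc m) f≤g =
  +-mono-≤ (∑-mono-≤ m (λ x → f≤g (outside ∷ x))) (∑-mono-≤ m (λ x → f≤g (inside ∷ x)))

∑-distrib-+ : ∀ m (f g : Subset m → ℕ) → ∑ m (λ x → f x + g x) ≡ ∑ m f + ∑ m g
∑-distrib-+ zero f g = refl
∑-distrib-+ (suc m) f g = begin
    ∑ m (λ x → f₀ x + g₀ x) + ∑ m (λ x → f₁ x + g₁ x)
  ≡⟨ cong₂ _+_ (∑-distrib-+ m f₀ g₀) (∑-distrib-+ m f₁ g₁) ⟩
    (∑ m f₀ + ∑ m g₀) + (∑ m f₁ + ∑ m g₁)
  ≡⟨ interchange (∑ m f₀) (∑ m g₀) (∑ m f₁) (∑ m g₁) ⟩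
    (∑ m f₀ + ∑ m f₁) + (∑ m g₀ + ∑ m g₁) ∎
  where
    open ≡-Reasoning
    f₀ f₁ g₀ g₁ : Subset m → ℕ
    f₀ x = f (outside ∷ x)
    f₁ x = f (inside ∷ x)
    g₀ x = g (outside ∷ x)
    g₁ x = g (inside ∷ x)

∑-*ʳ : ∀ m (f : Subset m → ℕ) c → ∑ m (λ x → f x * c) ≡ ∑ m f * c
∑-*ʳ zero f c = refl
∑-*ʳ (suc m) f c =
  trans (cong₂ _+_ (∑-*ʳ m f₀ c) (∑-*ʳ m f₁ c)) (sym (*-distribʳ-+ c (∑ m f₀) (∑ m f₁)))
  where
    f₀ f₁ : Subset m → ℕ
    f₀ x = f (outside ∷ x)
    f₁ x = f (inside ∷ x)

∑-zero : ∀ m {f : Subset m → ℕ} → (∀ x → f x ≡ 0) → ∑ m f ≡ 0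
∑-zero zero f≗0 = f≗0 []
∑-zero (suc m) f≗0 =
  cong₂ _+_ (∑-zero m (λ x → f≗0 (outside ∷ x))) (∑-zero m (λ x → f≗0 (inside ∷ x)))

∑-++ : ∀ q m (f : Subset (q + m) → ℕ) → ∑ (q + m) f ≡ ∑ q (λ a → ∑ m (λ g → f (a ++ g)))
∑-++ zero m f = refl
∑-++ (suc q) m f =
  cong₂ _+_ (∑-++ q m (λ x → f (outside ∷ x))) (∑-++ q m (λ x → f (inside ∷ x)))

∑-point : ∀ m (c : Subset m) {f : Subset m → ℕ} → (∀ x → x ≢ c → f x ≡ 0) → ∑ m f ≡ f c
∑-point zero [] f = refl
∑-point (suc m) (outside ∷ c) off =
  trans (cong₂ _+_ (∑-point m c (λ x x≢c → off (outside ∷ x) (x≢c ∘ cong tail)))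
                   (∑-zero m (λ x → off (inside ∷ x) (λ ()))))
        (+-identityʳ _)
∑-point (suc m) (inside ∷ c) off =
  cong₂ _+_ (∑-zero m (λ x → off (outside ∷ x) (λ ())))
            (∑-point m c (λ x x≢c → off (inside ∷ x) (x≢c ∘ cong tail)))

length-filterᵇ : ∀ {A : Set} (p : A → Bool) xs →
  length (filterᵇ p xs) ≡ sum (map (λ x → 𝟙 (p x)) xs)
length-filterᵇ p List.[] = refl
length-filterᵇ p (x List.∷ xs) with p x
... | true = cong suc (length-filterᵇ p xs)
... | false = length-filterᵇ p xs

sum-map-allSubsets : ∀ m (f : Subset m → ℕ) → sum (map f (allSubsets m)) ≡ ∑ m f
sum-map-allSubsets zero f = +-identityʳ (f [])
sum-map-allSubsets (suc m) f = begin
    sum (map f (map (outside ∷_) xs List.++ map (inside ∷_) xs))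
  ≡⟨ cong sum (Listₚ.map-++ f (map (outside ∷_) xs) _) ⟩
    sum (map f (map (outside ∷_) xs) List.++ map f (map (inside ∷_) xs))
  ≡⟨ sum-++ (map f (map (outside ∷_) xs)) _ ⟩
    sum (map f (map (outside ∷_) xs)) + sum (map f (map (inside ∷_) xs))
  ≡⟨ cong₂ _+_ (cong sum (sym (Listₚ.map-∘ xs))) (cong sum (sym (Listₚ.map-∘ xs))) ⟩
    sum (map (λ g → f (outside ∷ g)) xs) + sum (map (λ g → f (inside ∷ g)) xs)
  ≡⟨ cong₂ _+_ (sum-map-allSubsets m _) (sum-map-allSubsets m _) ⟩
    ∑ (suc m) f ∎
  where
    open ≡-Reasoning
    xs : List (Subset m)
    xs = allSubsets m

length-filterᵇ-allSubsets : ∀ {m} (A : Family m) → length (filterᵇ A (allSubsets m)) ≡ count A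
length-filterᵇ-allSubsets {m} A =
  trans (length-filterᵇ A (allSubsets m)) (sum-map-allSubsets m (λ g → 𝟙 (A g)))

count-mono-≤ : ∀ {m} {A B : Family m} → (∀ g → A g ≡ true → B g ≡ true) → count A ≤ count B
count-mono-≤ {m} A⊆B = ∑-mono-≤ m (λ g → 𝟙-mono-≤ (A⊆B g))

count-empty : ∀ {m} {A : Family m} → (∀ g → A g ≢ true) → count A ≡ 0
count-empty {m} {A} A≡∅ = ∑-zero m 𝟙A≡0
  where
    𝟙A≡0 : ∀ g → 𝟙 (A g) ≡ 0
    𝟙A≡0 g with A g in eq
    ... | false = refl
    ... | true = contradiction eq (A≡∅ g)

weight-suc : ∀ {m} (A : Family m) (w : Subset m → ℕ) →
  weight A (λ g → suc (w g)) ≡ count A + weight A w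
weight-suc {m} A w = trans (∑-cong m (λ g → *-suc (𝟙 (A g)) (w g))) (∑-distrib-+ m _ _)

weight-const : ∀ {m} {A : Family m} {w : Subset m → ℕ} {c} →
  (∀ g → A g ≡ true → w g ≡ c) → weight A w ≡ count A * c
weight-const {m} {A} {w} {c} w≡c = trans (∑-cong m on-A) (∑-*ʳ m (λ g → 𝟙 (A g)) c)
  where
    on-A : ∀ g → 𝟙 (A g) * w g ≡ 𝟙 (A g) * c
    on-A g with A g in eq
    ... | false = refl
    ... | true = cong (1 *_) (w≡c g eq)

0<nCk : ∀ {n k} → k ≤ n → 0 < n C k
0<nCk {n} {zero} _ = s≤s z≤n
0<nCk {suc n} {suc k} (s≤s k≤n) =
  ≤-trans (0<nCk k≤n) (subst (n C k ≤_) (nCk+nC[k+1]≡[n+1]C[k+1] n k) (m≤m+n _ _))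

nCk≡0⇒n<k : ∀ {n k} → n C k ≡ 0 → n < k
nCk≡0⇒n<k {n} {k} nCk≡0 with k ≤? n
... | yes k≤n = contradiction (sym nCk≡0) (<⇒≢ (0<nCk k≤n))
... | no k≰n = ≰⇒> k≰n

nC[k+1]*[k+1]≡nCk*[n∸k] : ∀ n k → (n C suc k) * suc k ≡ (n C k) * (n ∸ k)
nC[k+1]*[k+1]≡nCk*[n∸k] zero k =
  sym (trans (cong ((zero C k) *_) (0∸n≡0 k)) (*-zeroʳ (zero C k)))
nC[k+1]*[k+1]≡nCk*[n∸k] (suc n) zero =
  trans (*-identityʳ _) (trans (nC1≡n (suc n)) (sym (+-identityʳ _)))
nC[k+1]*[k+1]≡nCk*[n∸k] (suc n) (suc k) = begin
    (suc n C suc (suc k)) * suc (suc k)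
  ≡⟨ cong (_* suc (suc k)) (nCk+nC[k+1]≡[n+1]C[k+1] n (suc k)) ⟨
    (c + (n C suc (suc k))) * suc (suc k)
  ≡⟨ *-distribʳ-+ (suc (suc k)) c _ ⟩
    c * suc (suc k) + (n C suc (suc k)) * suc (suc k)
  ≡⟨ cong₂ _+_ (*-suc c (suc k)) (nC[k+1]*[k+1]≡nCk*[n∸k] n (suc k)) ⟩
    (c + c * suc k) + c * (n ∸ suc k)
  ≡⟨ cong (λ t → (c + t) + c * (n ∸ suc k)) (nC[k+1]*[k+1]≡nCk*[n∸k] n k) ⟩
    (c + (n C k) * (n ∸ k)) + c * (n ∸ suc k)
  ≡⟨ cong (_+ c * (n ∸ suc k)) (+-comm c _) ⟩
    ((n C k) * (n ∸ k) + c) + c * (n ∸ suc k)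
  ≡⟨ +-assoc ((n C k) * (n ∸ k)) c _ ⟩
    (n C k) * (n ∸ k) + (c + c * (n ∸ suc k))
  ≡⟨ cong ((n C k) * (n ∸ k) +_) c*suc[n∸k+1]≡c*[n∸k] ⟩
    (n C k) * (n ∸ k) + c * (n ∸ k)
  ≡⟨ *-distribʳ-+ (n ∸ k) (n C k) c ⟨
    ((n C k) + c) * (n ∸ k)
  ≡⟨ cong (_* (n ∸ k)) (nCk+nC[k+1]≡[n+1]C[k+1] n k) ⟩
    (suc n C suc k) * (n ∸ k) ∎
  where
    open ≡-Reasoning
    c : ℕ
    c = n C suc k
    c*suc[n∸k+1]≡c*[n∸k] : c + c * (n ∸ suc k) ≡ c * (n ∸ k)
    c*suc[n∸k+1]≡c*[n∸k] with suc k ≤? n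
    ... | yes k<n = trans (sym (*-suc c (n ∸ suc k))) (cong (c *_) (sym (+-∸-assoc 1 k<n)))
    ... | no k≮n rewrite k>n⇒nCk≡0 {n} {suc k} (≰⇒> k≮n) = refl

*-cross-trans : ∀ {a b c x y z} → (y ≡ 0 → a ≡ 0) → a * y ≤ b * x → b * z ≤ c * y → a * z ≤ c * x
*-cross-trans {zero} _ _ _ = z≤n
*-cross-trans {suc _} {y = zero} y≡0⇒a≡0 _ _ = contradiction (y≡0⇒a≡0 refl) (λ ())
*-cross-trans {a@(suc _)} {b} {c} {x} {y@(suc _)} {z} _ ay≤bx bz≤cy =
  *-cancelʳ-≤ (a * z) (c * x) y (begin
    a * z * y  ≡⟨ xy∙z≈xz∙y a z y ⟩
    a * y * z  ≤⟨ *-monoˡ-≤ z ay≤bx ⟩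
    b * x * z  ≡⟨ xy∙z≈xz∙y b x z ⟩
    b * z * x  ≤⟨ *-monoˡ-≤ x bz≤cy ⟩
    c * y * x  ≡⟨ xy∙z≈xz∙y c y x ⟩
    c * x * y  ∎)
  where open ≤-Reasoning

infix 4 _⋖_

data _⋖_ : ∀ {n} → Subset n → Subset n → Set where
  add : ∀ {n} {p : Subset n} → (outside ∷ p) ⋖ (inside ∷ p)
  keep : ∀ {n} x {p q : Subset n} → p ⋖ q → (x ∷ p) ⋖ (x ∷ q)

⋖⇒∣∣≡suc : ∀ {n} {p q : Subset n} → p ⋖ q → ∣ q ∣ ≡ suc ∣ p ∣
⋖⇒∣∣≡suc add = refl
⋖⇒∣∣≡suc (keep inside p⋖q) = cong suc (⋖⇒∣∣≡suc p⋖q)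
⋖⇒∣∣≡suc (keep outside p⋖q) = ⋖⇒∣∣≡suc p⋖q

⋖⇒∣∣< : ∀ {n} {p q : Subset n} → p ⋖ q → ∣ p ∣ < ∣ q ∣
⋖⇒∣∣< p⋖q = ≤-reflexive (sym (⋖⇒∣∣≡suc p⋖q))

⋖*⇒∣∣≤ : ∀ {n} {p q : Subset n} → Star _⋖_ p q → ∣ p ∣ ≤ ∣ q ∣
⋖*⇒∣∣≤ ε = ≤-refl
⋖*⇒∣∣≤ (p⋖r ◅ r⋖*q) = ≤-trans (<⇒≤ (⋖⇒∣∣< p⋖r)) (⋖*⇒∣∣≤ r⋖*q)

⊆⇒⋖* : ∀ {n} {p q : Subset n} → p ⊆ q → Star _⋖_ p q
⊆⇒⋖* {p = []} {[]} _ = ε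
⊆⇒⋖* {p = outside ∷ p} {outside ∷ q} p⊆q = gmap (outside ∷_) (keep outside) (⊆⇒⋖* (drop-∷-⊆ p⊆q))
⊆⇒⋖* {p = outside ∷ p} {inside ∷ q} p⊆q =
  gmap (outside ∷_) (keep outside) (⊆⇒⋖* (drop-∷-⊆ p⊆q)) ◅◅ (add ◅ ε)
⊆⇒⋖* {p = inside ∷ p} {inside ∷ q} p⊆q = gmap (inside ∷_) (keep inside) (⊆⇒⋖* (drop-∷-⊆ p⊆q))
⊆⇒⋖* {p = inside ∷ p} {outside ∷ q} p⊆q = contradiction (p⊆q here) (λ ())

⋖-++ : ∀ {q m} (a : Subset q) {h g : Subset m} → h ⋖ g → (a ++ h) ⋖ (a ++ g)
⋖-++ [] h⋖g = h⋖g
⋖-++ (x ∷ a) h⋖g = keep x (⋖-++ a h⋖g)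

map-fsuc⁺ : ∀ {n} {xs ys : List (Fin n)} →
  Pointwise Fin._≤_ xs ys → Pointwise Fin._≤_ (map fsuc xs) (map fsuc ys)
map-fsuc⁺ = map⁺ fsuc fsuc ∘ Pointwise.map s≤s

∷-≺ : ∀ {n} x {p q : Subset n} → p ≺ q → (x ∷ p) ≺ (x ∷ q)
∷-≺ inside p≺q = z≤n ∷ map-fsuc⁺ p≺q
∷-≺ outside p≺q = map-fsuc⁺ p≺q

⋖⇒inside∷≺outside∷ : ∀ {n} {p q : Subset n} → p ⋖ q → (inside ∷ p) ≺ (outside ∷ q)
⋖⇒inside∷≺outside∷ add = z≤n ∷ Pointwise.refl Finₚ.≤-refl
⋖⇒inside∷≺outside∷ (keep inside p⋖q) = z≤n ∷ map-fsuc⁺ (⋖⇒inside∷≺outside∷ p⋖q)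
⋖⇒inside∷≺outside∷ (keep outside p⋖q) = lower-head (map-fsuc⁺ (⋖⇒inside∷≺outside∷ p⋖q))
  where
    lower-head : ∀ {n x} {xs ys : List (Fin (suc n))} →
      Pointwise Fin._≤_ (x List.∷ xs) ys → Pointwise Fin._≤_ (fzero List.∷ xs) ys
    lower-head (_ ∷ xs≤ys) = z≤n ∷ xs≤ys

⋖-shift-≺ : ∀ {q m} {u w : Subset q} {h g : Subset m} → u ⋖ w → h ⋖ g → (w ++ h) ≺ (u ++ g)
⋖-shift-≺ {u = outside ∷ a} add h⋖g = ⋖⇒inside∷≺outside∷ (⋖-++ a h⋖g)
⋖-shift-≺ (keep x u⋖w) h⋖g = ∷-≺ x (⋖-shift-≺ u⋖w h⋖g)

ShadowIn : ∀ {m} → Family m → Family m → Set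
ShadowIn {m} A B = ∀ {h g : Subset m} → h ⋖ g → A g ≡ true → B h ≡ true

-- Double counting the pairs h ⋖ g with g ∈ A: each g ∈ A lies above ∣ g ∣ of them, all with
-- h ∈ B, and each h lies below m ∸ ∣ h ∣ sets g.
weight-size≤weight-cosize : ∀ m {A B : Family m} → ShadowIn A B →
  weight A ∣_∣ ≤ weight B (λ h → m ∸ ∣ h ∣)
weight-size≤weight-cosize zero {A} _ = ≤-trans (≤-reflexive (*-zeroʳ (𝟙 (A [])))) z≤n
weight-size≤weight-cosize (suc m) {A} {B} ∂A⊆B = begin
    weight A₀ ∣_∣ + weight A₁ (λ g → suc ∣ g ∣)
  ≡⟨ cong (weight A₀ ∣_∣ +_) (weight-suc A₁ ∣_∣) ⟩
    weight A₀ ∣_∣ + (count A₁ + weight A₁ ∣_∣)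
  ≤⟨ +-mono-≤ (weight-size≤weight-cosize m (∂A⊆B ∘ keep outside))
              (+-mono-≤ (count-mono-≤ {A = A₁} {B₀} (λ g → ∂A⊆B (add {p = g})))
                        (weight-size≤weight-cosize m (∂A⊆B ∘ keep inside))) ⟩
    weight B₀ cosize + (count B₀ + weight B₁ cosize)
  ≡⟨ +-assoc (weight B₀ cosize) (count B₀) _ ⟨
    (weight B₀ cosize + count B₀) + weight B₁ cosize
  ≡⟨ cong (_+ weight B₁ cosize) (+-comm (weight B₀ cosize) (count B₀)) ⟩
    (count B₀ + weight B₀ cosize) + weight B₁ cosize
  ≡⟨ cong (_+ weight B₁ cosize) (weight-suc B₀ cosize) ⟨
    weight B₀ (λ h → suc (m ∸ ∣ h ∣)) + weight B₁ cosize
  ≡⟨ cong (_+ weight B₁ cosize) (∑-cong m (λ h → cong (𝟙 (B₀ h) *_) (+-∸-assoc 1 (∣p∣≤n h)))) ⟨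
    weight B₀ (λ h → suc m ∸ ∣ h ∣) + weight B₁ cosize ∎
  where
    open ≤-Reasoning
    A₀ A₁ B₀ B₁ : Family m
    A₀ g = A (outside ∷ g)
    A₁ g = A (inside ∷ g)
    B₀ h = B (outside ∷ h)
    B₁ h = B (inside ∷ h)
    cosize : Subset m → ℕ
    cosize h = m ∸ ∣ h ∣

localLYM : ∀ m s {A B : Family m} →
  (∀ g → A g ≡ true → ∣ g ∣ ≡ suc s) → (∀ h → B h ≡ true → ∣ h ∣ ≡ s) → ShadowIn A B →
  count A * (m C s) ≤ count B * (m C suc s)
localLYM m s {A} {B} A-size B-size ∂A⊆B = *-cancelʳ-≤ _ _ (suc s) (begin
    count A * (m C s) * suc s           ≡⟨ xy∙z≈xz∙y (count A) (m C s) (suc s) ⟩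
    count A * suc s * (m C s)           ≡⟨ cong (_* (m C s)) (weight-const A-size) ⟨
    weight A ∣_∣ * (m C s)              ≤⟨ *-monoˡ-≤ (m C s) (weight-size≤weight-cosize m ∂A⊆B) ⟩
    weight B (λ h → m ∸ ∣ h ∣) * (m C s) ≡⟨ cong (_* (m C s)) (weight-const B-cosize) ⟩
    count B * (m ∸ s) * (m C s)         ≡⟨ xy∙z≈xz∙y (count B) (m ∸ s) (m C s) ⟩
    count B * (m C s) * (m ∸ s)         ≡⟨ *-assoc (count B) (m C s) (m ∸ s) ⟩
    count B * ((m C s) * (m ∸ s))       ≡⟨ cong (count B *_) (nC[k+1]*[k+1]≡nCk*[n∸k] m s) ⟨
    count B * ((m C suc s) * suc s)     ≡⟨ *-assoc (count B) (m C suc s) (suc s) ⟨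
    count B * (m C suc s) * suc s       ∎)
  where
    open ≤-Reasoning
    B-cosize : ∀ h → B h ≡ true → m ∸ ∣ h ∣ ≡ m ∸ s
    B-cosize h = cong (m ∸_) ∘ B-size h

initSeg≡⊤++⊥ : ∀ q m → initSeg (q + m) q ≡ ⊤ {q} ++ ⊥ {m}
initSeg≡⊤++⊥ zero zero = refl
initSeg≡⊤++⊥ zero (suc m) = cong (outside ∷_) (initSeg≡⊤++⊥ zero m)
initSeg≡⊤++⊥ (suc q) m = cong (inside ∷_) (initSeg≡⊤++⊥ q m)

++-∩-initSeg : ∀ {q m} (a : Subset q) (g : Subset m) → (a ++ g) ∩ initSeg (q + m) q ≡ a ++ ⊥
++-∩-initSeg {q} {m} a g = begin
    (a ++ g) ∩ initSeg (q + m) q  ≡⟨ cong ((a ++ g) ∩_) (initSeg≡⊤++⊥ q m) ⟩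
    (a ++ g) ∩ (⊤ {q} ++ ⊥ {m})   ≡⟨ zipWith-++ _∧_ a g ⊤ ⊥ ⟩
    (a ∩ ⊤) ++ (g ∩ ⊥)            ≡⟨ cong₂ _++_ (∩-identityʳ a) (∩-zeroʳ g) ⟩
    a ++ ⊥                        ∎
  where open ≡-Reasoning

==ˢ-true : ∀ {n} {p q : Subset n} → p ≡ q → (p ==ˢ q) ≡ true
==ˢ-true {p = p} {q} p≡q = trans (isYes≗does p≟q) (dec-true p≟q p≡q)
  where
    p≟q : Dec (p ≡ q)
    p≟q = ≡-dec BoolP._≟_ p q

==ˢ-false : ∀ {n} {p q : Subset n} → p ≢ q → (p ==ˢ q) ≡ false
==ˢ-false {p = p} {q} p≢q = trans (isYes≗does p≟q) (dec-false p≟q p≢q)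
  where
    p≟q : Dec (p ≡ q)
    p≟q = ≡-dec BoolP._≟_ p q

∣p++q∣≡∣p∣+∣q∣ : ∀ {q m} (a : Subset q) (g : Subset m) → ∣ a ++ g ∣ ≡ ∣ a ∣ + ∣ g ∣
∣p++q∣≡∣p∣+∣q∣ [] g = refl
∣p++q∣≡∣p∣+∣q∣ (inside ∷ a) g = cong suc (∣p++q∣≡∣p∣+∣q∣ a g)
∣p++q∣≡∣p∣+∣q∣ (outside ∷ a) g = ∣p++q∣≡∣p∣+∣q∣ a g

∣p++⊥∣≡∣p∣ : ∀ {q} m (a : Subset q) → ∣ a ++ ⊥ {m} ∣ ≡ ∣ a ∣
∣p++⊥∣≡∣p∣ m a = trans (∣p++q∣≡∣p∣+∣q∣ a ⊥) (trans (cong (∣ a ∣ +_) (∣⊥∣≡0 m)) (+-identityʳ _))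

++-⊆⁻ˡ : ∀ {q m} (a b : Subset q) {c d : Subset m} → a ++ c ⊆ b ++ d → a ⊆ b
++-⊆⁻ˡ [] [] _ = ⊆-refl
++-⊆⁻ˡ (outside ∷ a) (_ ∷ b) a++c⊆b++d = out⊆ (++-⊆⁻ˡ a b (drop-∷-⊆ a++c⊆b++d))
++-⊆⁻ˡ (inside ∷ a) (inside ∷ b) a++c⊆b++d = s⊆s (++-⊆⁻ˡ a b (drop-∷-⊆ a++c⊆b++d))
++-⊆⁻ˡ (inside ∷ a) (outside ∷ b) a++c⊆b++d = contradiction (a++c⊆b++d here) (λ ())

⊆⊤++⊥⇒≡++⊥ : ∀ q {m} (r : Subset (q + m)) → r ⊆ ⊤ {q} ++ ⊥ {m} → ∃[ a ] r ≡ a ++ ⊥ {m}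
⊆⊤++⊥⇒≡++⊥ zero r r⊆⊥ = [] , ⊆-antisym r⊆⊥ ⊥⊆
⊆⊤++⊥⇒≡++⊥ (suc q) (x ∷ r) x∷r⊆⊤++⊥ with ⊆⊤++⊥⇒≡++⊥ q r (drop-∷-⊆ x∷r⊆⊤++⊥)
... | a , refl = x ∷ a , refl

module _ {q m : ℕ} (𝓕 : Family (q + m)) where

  trace : Subset q → ℕ
  trace a = count (λ g → 𝓕 (a ++ g))

  restrictCard-++⊥ : ∀ a → restrictCard 𝓕 q (a ++ ⊥) ≡ trace a
  restrictCard-++⊥ a = begin
      restrictCard 𝓕 q (a ++ ⊥)
    ≡⟨ length-filterᵇ-allSubsets (λ F → 𝓕 F ∧ is-a F) ⟩
      count (λ F → 𝓕 F ∧ is-a F)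
    ≡⟨ ∑-++ q m _ ⟩
      ∑ q (λ b → count (λ g → 𝓕 (b ++ g) ∧ is-a (b ++ g)))
    ≡⟨ ∑-point q a b≢a⇒0 ⟩
      count (λ g → 𝓕 (a ++ g) ∧ is-a (a ++ g))
    ≡⟨ ∑-cong m (λ g → cong 𝟙 (trans (cong (𝓕 (a ++ g) ∧_) (is-a-a g)) (∧-identityʳ _))) ⟩
      trace a ∎
    where
      open ≡-Reasoning
      is-a : Family (q + m)
      is-a F = (F ∩ initSeg (q + m) q) ==ˢ (a ++ ⊥)
      is-a-a : ∀ g → is-a (a ++ g) ≡ true
      is-a-a g = ==ˢ-true (++-∩-initSeg a g)
      b≢a⇒0 : ∀ b → b ≢ a → count (λ g → 𝓕 (b ++ g) ∧ is-a (b ++ g)) ≡ 0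
      b≢a⇒0 b b≢a = ∑-zero m (λ g → cong 𝟙 (trans (cong (𝓕 (b ++ g) ∧_) (is-a-b g)) (∧-zeroʳ _)))
        where
          is-a-b : ∀ g → is-a (b ++ g) ≡ false
          is-a-b g = ==ˢ-false (b≢a ∘ ++-injectiveˡ b a ∘ trans (sym (++-∩-initSeg b g)))

  module _ {k : ℕ} (uniform : IsKUniform k 𝓕) (initial : Initial 𝓕) where

    trace-size : ∀ (a : Subset q) (g : Subset m) → 𝓕 (a ++ g) ≡ true → ∣ g ∣ ≡ k ∸ ∣ a ∣
    trace-size a g a++g∈𝓕 = sym (begin
      k ∸ ∣ a ∣             ≡⟨ cong (_∸ ∣ a ∣) (uniform (a ++ g) a++g∈𝓕) ⟨
      ∣ a ++ g ∣ ∸ ∣ a ∣     ≡⟨ cong (_∸ ∣ a ∣) (∣p++q∣≡∣p∣+∣q∣ a g) ⟩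
      ∣ a ∣ + ∣ g ∣ ∸ ∣ a ∣  ≡⟨ m+n∸m≡n ∣ a ∣ ∣ g ∣ ⟩
      ∣ g ∣                 ∎)
      where open ≡-Reasoning

    trace-empty : ∀ {a} → m < k ∸ ∣ a ∣ → trace a ≡ 0
    trace-empty {a} m<k∸∣a∣ = count-empty (λ g a++g∈𝓕 →
      <⇒≱ m<k∸∣a∣ (subst (_≤ m) (trace-size a g a++g∈𝓕) (∣p∣≤n g)))

    trace-⋖ : ∀ {u w} → u ⋖ w → ∣ w ∣ ≤ k →
      trace u * (m C (k ∸ ∣ w ∣)) ≤ trace w * (m C (k ∸ ∣ u ∣))
    trace-⋖ {u} {w} u⋖w ∣w∣≤k =
      subst (λ t → trace u * (m C s) ≤ trace w * (m C t)) (sym k∸∣u∣≡suc-s)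
      (localLYM m s (λ g u++g∈𝓕 → trans (trace-size u g u++g∈𝓕) k∸∣u∣≡suc-s) (trace-size w)
        (λ h⋖g u++g∈𝓕 → initial _ _ (⋖-shift-≺ u⋖w h⋖g) u++g∈𝓕))
      where
        s : ℕ
        s = k ∸ ∣ w ∣
        k∸∣u∣≡suc-s : k ∸ ∣ u ∣ ≡ suc s
        k∸∣u∣≡suc-s = trans (cong (suc k ∸_) (sym (⋖⇒∣∣≡suc u⋖w))) (+-∸-assoc 1 ∣w∣≤k)

    trace-⋖* : ∀ {u r} → Star _⋖_ u r → ∣ r ∣ ≤ k →
      trace u * (m C (k ∸ ∣ r ∣)) ≤ trace r * (m C (k ∸ ∣ u ∣))
    trace-⋖* ε _ = ≤-refl
    trace-⋖* {u} {r} (_◅_ {j = w} u⋖w w⋖*r) ∣r∣≤k =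
      *-cross-trans {trace u} {trace w} {trace r} {N u} {N w} {N r}
        vanishes (trace-⋖ u⋖w ∣w∣≤k) (trace-⋖* w⋖*r ∣r∣≤k)
      where
        ∣w∣≤k : ∣ w ∣ ≤ k
        ∣w∣≤k = ≤-trans (⋖*⇒∣∣≤ w⋖*r) ∣r∣≤k
        N : Subset q → ℕ
        N v = m C (k ∸ ∣ v ∣)
        vanishes : N w ≡ 0 → trace u ≡ 0
        vanishes Cw≡0 = trace-empty {u} (<-≤-trans (nCk≡0⇒n<k Cw≡0)
          (∸-monoʳ-≤ k (<⇒≤ (⋖⇒∣∣< u⋖w))))

lemma2p5 : (n k : ℕ) (𝓕 : Family n) → IsKUniform k 𝓕 → Initial 𝓕 →
    (q : ℕ) → 0 < q → q < n →
    (P R : Subset n) → P ⊆ R → R ⊆ initSeg n q → ∣ R ∣ ≤ k →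
    restrictCard 𝓕 q P * ((n ∸ q) C (k ∸ ∣ R ∣))
    ≤ restrictCard 𝓕 q R * ((n ∸ q) C (k ∸ ∣ P ∣))
lemma2p5 n k 𝓕 uniform initial q _ q<n P R P⊆R R⊆[q] ∣R∣≤k
  with m , refl ← m≤n⇒∃[o]m+o≡n (<⇒≤ q<n)
  with b , refl ← ⊆⊤++⊥⇒≡++⊥ q R (subst (R ⊆_) (initSeg≡⊤++⊥ q m) R⊆[q])
  with a , refl ← ⊆⊤++⊥⇒≡++⊥ q P (⊆-trans P⊆R (subst (b ++ ⊥ ⊆_) (initSeg≡⊤++⊥ q m) R⊆[q]))
  rewrite m+n∸m≡n q m | ∣p++⊥∣≡∣p∣ m a | ∣p++⊥∣≡∣p∣ m b
        | restrictCard-++⊥ 𝓕 a | restrictCard-++⊥ 𝓕 b =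
  trace-⋖* 𝓕 uniform initial (⊆⇒⋖* (++-⊆⁻ˡ a b P⊆R)) ∣R∣≤k
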